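{- Let $S$ be a reflective numerical semigroup with genus $g(S)=g\ge1$ and multiplicity $m(S)=a$. Let $q=\lfloor g/a\rfloor$ and $r=g-qa$. Then \[ \mathrm{PF}(S)=[g-(r-1),\,g-1]_{\mathbb{Z}}\cup\{2g-r\}. \] In particular, the type of $S$ is $t(S)=r$.
   Context: A numerical semigroup is a submonoid $S$ of $(\mathbb{N}_0,+)$ with finite complement; $\mathcal{H}(S)=\mathbb{N}_0\setminus S$, $g(S)=\#\mathcal{H}(S)$, $m(S)$ is the smallest positive element of $S$. The set of pseudo-Frobenius numbers is $\mathrm{PF}(S)=\{h\in\mathcal{H}(S): h+s\in S \text{ for all } 0\ne s\in S\}$ and the type is $t(S)=\#\mathrm{PF}(S)$. $[u,v]_{\mathbb{Z}}=\{n\in\mathbb{Z}:u\le n\le v\}$ (empty if $u>v$). $S$ (with $g=g(S)\ge1$) is reflective if for every $z\in[0,g-1]_{\mathbb{Z}}$ exactly one of $z$ and $z+g$ lies in $S$. -}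

module Defs where

open import Data.Nat using (ℕ; zero; suc; _+_; _*_; _∸_; _≤_; _<_)
open import Data.Bool using (Bool; true; false)
open import Data.Product using (Σ; ∃; _×_; _,_)
open import Data.Sum using (_⊎_)
open import Data.List using (List; length)
open import Data.List.Membership.Propositional using (_∈_)
open import Data.List.Relation.Unary.Unique.Propositional using (Unique)
open import Relation.Binary.PropositionalEquality using (_≡_)
open import Relation.Nullary using (¬_)
open import Function.Bundles using (_⇔_)

-- A numerical semigroup: a submonoid of (ℕ,+) with finite complement.
-- Membership is given as a Bool-valued characteristic function
-- (every numerical semigroup is decidable, being cofinite).
record NumericalSemigroup : Set where
  field
    mem      : ℕ → Bool
    zero∈    : mem 0 ≡ true
    closed   : ∀ x y → mem x ≡ true → mem y ≡ true → mem (x + y) ≡ true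
    cofinite : ∃ λ N → ∀ n → N ≤ n → mem n ≡ true

open NumericalSemigroup public

_∈S_ : ℕ → NumericalSemigroup → Set
n ∈S S = mem S n ≡ true

_∉S_ : ℕ → NumericalSemigroup → Set
n ∉S S = ¬ (n ∈S S)

HasCard : (ℕ → Set) → ℕ → Set
HasCard P n = Σ (List ℕ) λ L → Unique L × (∀ x → (x ∈ L) ⇔ P x) × length L ≡ n

IsHole : NumericalSemigroup → ℕ → Set
IsHole S h = h ∉S S

IsGenus : NumericalSemigroup → ℕ → Set
IsGenus S g = HasCard (IsHole S) g

IsMultiplicity : NumericalSemigroup → ℕ → Set
IsMultiplicity S a = 0 < a × a ∈S S × (∀ b → 0 < b → b < a → b ∉S S)

IsPF : NumericalSemigroup → ℕ → Set
IsPF S h = IsHole S h × (∀ s → 0 < s → s ∈S S → (h + s) ∈S S)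

IsType : NumericalSemigroup → ℕ → Set
IsType S t = HasCard (IsPF S) t

IsReflective : NumericalSemigroup → Set
IsReflective S = Σ ℕ λ g → IsGenus S g × 1 ≤ g ×
  (∀ z → z < g → (z ∈S S × (z + g) ∉S S) ⊎ (z ∉S S × (z + g) ∈S S))

{-# OPTIONS --safe #-}
module Submission where

-- Exactly one of z, z + g (z < g) is a hole, which
-- already accounts for all g holes, so every n ≥ 2g lies in S. An element z < g of S with
-- z ≥ a has z - a ∈ S (otherwise z - a + g ∈ S, hence z + g ∈ S), so S ∩ [0, g) consists of the
-- multiples of a, the largest being q a. Then every hole h with q a < h < g absorbs S, and so
-- does q a + g = 2g - r. A hole h = c + m a ≤ q a is refuted by adding (q - m) a when c ≤ r and
-- a - c + g when c > r; a PF number h ≥ g has h - g = k a ∈ S, and k < q is refuted by h + a.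

open import Defs
open import Data.Bool using (true; false; if_then_else_)
open import Data.Bool.Properties using () renaming (_≟_ to _≟ᵇ_)
open import Data.Empty using (⊥; ⊥-elim)
open import Data.Fin as Fin using (Fin; toℕ)
open import Data.Fin.Properties using (injective⇒≤; toℕ-injective; toℕ<n)
open import Data.List using (List; []; _∷_; length; lookup; applyUpTo)
open import Data.List.Membership.Propositional using (_∈_)
open import Data.List.Membership.Propositional.Properties using (∈-lookup; ∈-applyUpTo⁺; ∈-applyUpTo⁻)
open import Data.List.Membership.Setoid.Properties using (index-injective)
open import Data.List.Properties using (length-applyUpTo)
open import Data.List.Relation.Unary.All as All using ()
open import Data.List.Relation.Unary.AllPairs using (_∷_)
open import Data.List.Relation.Unary.Any as Any using ()
open import Data.List.Relation.Unary.Unique.Propositional using (Unique)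
open import Data.List.Relation.Unary.Unique.Propositional.Properties using (applyUpTo⁺₁)
open import Data.Nat
open import Data.Nat.Divisibility using (_∣_; divides; m%n≡0⇒n∣m)
open import Data.Nat.DivMod using (_%_; _/_; m≡m%n+[m/n]*n; m%n<n)
open import Data.Nat.Properties
open import Algebra.Properties.CommutativeSemigroup +-commutativeSemigroup using (xy∙z≈xz∙y)
open import Data.Nat.Tactic.RingSolver using (solve)
open import Data.Product using (_×_; _,_; proj₁; proj₂)
open import Data.Sum using (_⊎_; inj₁; inj₂)
open import Data.Sum.Function.Propositional using (_⊎-⇔_)
open import Data.Product.Function.NonDependent.Propositional using (_×-⇔_)
open import Function.Bundles using (_⇔_; mk⇔; Equivalence)
open import Function.Construct.Composition using () renaming (equivalence to _⇔-then_)
open import Function.Construct.Symmetry using (⇔-sym)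
open import Function.Definitions using (Injective)
open import Relation.Nullary using (¬_; yes; no)
open import Relation.Nullary.Decidable using (decidable-stable)
open import Relation.Binary.PropositionalEquality

lookup-injective : ∀ {A : Set} {xs : List A} → Unique xs → Injective _≡_ _≡_ (lookup xs)
lookup-injective {xs = _ ∷ _} _ {Fin.zero} {Fin.zero} _ = refl
lookup-injective {xs = _ ∷ _} (x∉xs ∷ _) {Fin.zero} {Fin.suc j} eq =
  ⊥-elim (All.lookup x∉xs (∈-lookup j) eq)
lookup-injective {xs = _ ∷ _} (x∉xs ∷ _) {Fin.suc i} {Fin.zero} eq =
  ⊥-elim (All.lookup x∉xs (∈-lookup i) (sym eq))
lookup-injective {xs = _ ∷ _} (_ ∷ xs-unique) {Fin.suc i} {Fin.suc j} eq =
  cong Fin.suc (lookup-injective xs-unique eq)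

injective⇒≤length : ∀ {A : Set} {m} {f : Fin m → A} {ys : List A} →
  Injective _≡_ _≡_ f → (∀ i → f i ∈ ys) → m ≤ length ys
injective⇒≤length {A} f-injective f∈ys =
  injective⇒≤ {f = λ i → Any.index (f∈ys i)}
    (λ eq → f-injective (index-injective (setoid A) (f∈ys _) (f∈ys _) eq))

HasCard-unique : ∀ {P : ℕ → Set} {m n} → HasCard P m → HasCard P n → m ≡ n
HasCard-unique {P} p q = ≤-antisym (HasCard-≤ p q) (HasCard-≤ q p)
  where
  HasCard-≤ : ∀ {m n} → HasCard P m → HasCard P n → m ≤ n
  HasCard-≤ (xs , xs-unique , xs-spec , refl) (ys , _ , ys-spec , refl) =
    injective⇒≤length (lookup-injective xs-unique)
      (λ i → Equivalence.from (ys-spec _) (Equivalence.to (xs-spec _) (∈-lookup i)))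

*<*+⇒≤ : ∀ {a r} k q → r < a → k * a < q * a + r → k ≤ q
*<*+⇒≤ {a} {r} k q r<a k*a<q*a+r = s≤s⁻¹ (*-cancelʳ-< a k (suc q)
  (<-trans k*a<q*a+r (subst (q * a + r <_) (+-comm (q * a) a) (+-monoʳ-< (q * a) r<a))))

module Reflective (S : NumericalSemigroup) {g : ℕ} (0<g : 0 < g)
  (reflect : ∀ z → z < g → (z ∈S S × (z + g) ∉S S) ⊎ (z ∉S S × (z + g) ∈S S))
  (genus : IsGenus S g) where

  ∈⇒+g∉ : ∀ {z} → z < g → z ∈S S → (z + g) ∉S S
  ∈⇒+g∉ {z} z<g z∈S with reflect z z<g
  ... | inj₁ (_ , z+g∉S) = z+g∉S
  ... | inj₂ (z∉S , _) = ⊥-elim (z∉S z∈S)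

  ∉⇒+g∈ : ∀ {z} → z < g → z ∉S S → (z + g) ∈S S
  ∉⇒+g∈ {z} z<g z∉S with reflect z z<g
  ... | inj₁ (z∈S , _) = ⊥-elim (z∉S z∈S)
  ... | inj₂ (_ , z+g∈S) = z+g∈S

  +g∉⇒∈ : ∀ {z} → z < g → (z + g) ∉S S → z ∈S S
  +g∉⇒∈ {z} z<g z+g∉S with reflect z z<g
  ... | inj₁ (z∈S , _) = z∈S
  ... | inj₂ (_ , z+g∈S) = ⊥-elim (z+g∉S z+g∈S)

  g∉S : g ∉S S
  g∉S = ∈⇒+g∉ 0<g (zero∈ S)

  partner : ℕ → ℕ
  partner z = if mem S z then z + g else z

  partner-∉ : ∀ {z} → z < g → partner z ∉S S
  partner-∉ {z} z<g with mem S z in mem-z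
  ... | true = ∈⇒+g∉ z<g mem-z
  ... | false = subst (λ b → b ≢ true) (sym mem-z) λ ()

  partner-< : ∀ {z} → z < g → partner z < g + g
  partner-< {z} z<g with mem S z
  ... | true = +-monoˡ-< g z<g
  ... | false = <-≤-trans z<g (m≤m+n g g)

  partner-injective : ∀ {x y} → x < g → y < g → partner x ≡ partner y → x ≡ y
  partner-injective {x} {y} x<g y<g eq with mem S x | mem S y
  ... | true  | true  = +-cancelʳ-≡ g x y eq
  ... | true  | false = ⊥-elim (<⇒≱ y<g (subst (g ≤_) eq (m≤n+m g x)))
  ... | false | true  = ⊥-elim (<⇒≱ x<g (subst (g ≤_) (sym eq) (m≤n+m g y)))
  ... | false | false = eq

  ≥2g⇒∈ : ∀ {n} → g + g ≤ n → n ∈S S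
  ≥2g⇒∈ {n} 2g≤n = decidable-stable (mem S n ≟ᵇ true) n-not-hole
    where
    n-not-hole : ¬ n ∉S S
    n-not-hole n∉S = too-many-holes genus
      where
      hole : Fin (suc g) → ℕ
      hole Fin.zero = n
      hole (Fin.suc i) = partner (toℕ i)

      hole-∉ : ∀ i → hole i ∉S S
      hole-∉ Fin.zero = n∉S
      hole-∉ (Fin.suc i) = partner-∉ (toℕ<n i)

      hole-injective : Injective _≡_ _≡_ hole
      hole-injective {Fin.zero} {Fin.zero} _ = refl
      hole-injective {Fin.zero} {Fin.suc j} eq =
        ⊥-elim (<⇒≱ (partner-< (toℕ<n j)) (subst (g + g ≤_) eq 2g≤n))
      hole-injective {Fin.suc i} {Fin.zero} eq =
        ⊥-elim (<⇒≱ (partner-< (toℕ<n i)) (subst (g + g ≤_) (sym eq) 2g≤n))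
      hole-injective {Fin.suc i} {Fin.suc j} eq =
        cong Fin.suc (toℕ-injective (partner-injective (toℕ<n i) (toℕ<n j) eq))

      too-many-holes : IsGenus S g → ⊥
      too-many-holes (holes , _ , holes-spec , |holes|≡g) = 1+n≰n (subst (suc g ≤_) |holes|≡g
        (injective⇒≤length hole-injective (λ i → Equivalence.from (holes-spec _) (hole-∉ i))))

  +g∈ : ∀ {w} → (w < g → w ∉S S) → (w + g) ∈S S
  +g∈ {w} w∉S with w <? g
  ... | yes w<g = ∉⇒+g∈ w<g (w∉S w<g)
  ... | no w≮g = ≥2g⇒∈ (+-monoˡ-≤ g (≮⇒≥ w≮g))

  module Multiplicity {a : ℕ} (multiplicity : IsMultiplicity S a) where

    0<a : 0 < a
    0<a = proj₁ multiplicity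

    a∈S : a ∈S S
    a∈S = proj₁ (proj₂ multiplicity)

    0<b<a⇒∉ : ∀ {b} → 0 < b → b < a → b ∉S S
    0<b<a⇒∉ = proj₂ (proj₂ multiplicity) _

    instance
      a-nonZero : NonZero a
      a-nonZero = >-nonZero 0<a

    *a∈ : ∀ k → (k * a) ∈S S
    *a∈ zero = zero∈ S
    *a∈ (suc k) = closed S a (k * a) a∈S (*a∈ k)

    remainder-zero : ∀ k {c} → c < a → c + k * a < g → (c + k * a) ∈S S → c ≡ 0
    remainder-zero zero {zero} _ _ _ = refl
    remainder-zero zero {suc c} c<a _ c∈S =
      ⊥-elim (0<b<a⇒∉ z<s c<a (subst (_∈S S) (+-identityʳ (suc c)) c∈S))
    remainder-zero (suc k) {c} c<a z<g z∈S = remainder-zero k c<a w<g (+g∉⇒∈ w<g w+g∉S)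
      where
      w<g : c + k * a < g
      w<g = ≤-<-trans (+-monoʳ-≤ c (m≤n+m (k * a) a)) z<g
      rearrange : c + k * a + g + a ≡ c + suc k * a + g
      rearrange = solve (c ∷ k ∷ a ∷ g ∷ [])
      w+g∉S : (c + k * a + g) ∉S S
      w+g∉S w+g∈S = ∈⇒+g∉ z<g z∈S (subst (_∈S S) rearrange (closed S _ a w+g∈S a∈S))

    ∈⇒∣ : ∀ {z} → z < g → z ∈S S → a ∣ z
    ∈⇒∣ {z} z<g z∈S = m%n≡0⇒n∣m z a
      (remainder-zero (z / a) (m%n<n z a) (subst (_< g) z≡ z<g) (subst (_∈S S) z≡ z∈S))
      where
      z≡ : z ≡ z % a + z / a * a
      z≡ = m≡m%n+[m/n]*n z a

    module Division (q r : ℕ) (g≡qa+r : g ≡ q * a + r) (r<a : r < a) where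

      0<r : 0 < r
      0<r = n≢0⇒n>0 λ r≡0 → g∉S (subst (_∈S S) (sym (g≡qa r≡0)) (*a∈ q))
        where
        g≡qa : r ≡ 0 → g ≡ q * a
        g≡qa r≡0 = trans g≡qa+r (trans (cong (q * a +_) r≡0) (+-identityʳ (q * a)))

      qa<g : q * a < g
      qa<g = subst (q * a <_) (sym g≡qa+r) (m<m+n (q * a) 0<r)

      qa+c<g : ∀ {c} → c < r → q * a + c < g
      qa+c<g c<r = subst (q * a + _ <_) (sym g≡qa+r) (+-monoʳ-< (q * a) c<r)

      ∈⇒≤qa : ∀ {z} → z < g → z ∈S S → z ≤ q * a
      ∈⇒≤qa z<g z∈S with ∈⇒∣ z<g z∈S
      ... | divides k refl = *-monoˡ-≤ a (*<*+⇒≤ k q r<a (subst (k * a <_) g≡qa+r z<g))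

      >qa⇒+g∈ : ∀ {w} → q * a < w → (w + g) ∈S S
      >qa⇒+g∈ qa<w = +g∈ λ w<g w∈S → <⇒≱ qa<w (∈⇒≤qa w<g w∈S)

      top-PF : IsPF S (q * a + g)
      top-PF = ∈⇒+g∉ qa<g (*a∈ q) , closure
        where
        closure : ∀ s → 0 < s → s ∈S S → (q * a + g + s) ∈S S
        closure s 0<s _ = subst (_∈S S) (xy∙z≈xz∙y (q * a) s g) (>qa⇒+g∈ (m<m+n (q * a) 0<s))

      interval-PF : ∀ {h} → q * a < h → h < g → IsPF S h
      interval-PF {h} qa<h h<g = (λ h∈S → <⇒≱ qa<h (∈⇒≤qa h<g h∈S)) , closure
        where
        g<h+a : g < h + a
        g<h+a = subst (_< h + a) (sym g≡qa+r) (<-trans (+-monoʳ-< (q * a) r<a) (+-monoˡ-< a qa<h))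

        h+a∈S : (h + a) ∈S S
        h+a∈S with m≤n⇒∃[o]m+o≡n (<⇒≤ g<h+a)
        ... | w , g+w≡h+a = subst (_∈S S) (trans (+-comm w g) g+w≡h+a) (+g∈ λ _ → w∉S)
          where
          w∉S : w ∉S S
          w∉S = 0<b<a⇒∉
            (n≢0⇒n>0 λ { refl → <-irrefl (trans (sym (+-identityʳ g)) g+w≡h+a) g<h+a })
            (+-cancelˡ-< g w a (subst (_< g + a) (sym g+w≡h+a) (+-monoˡ-< a h<g)))

        closure : ∀ s → 0 < s → s ∈S S → (h + s) ∈S S
        closure s 0<s s∈S with s <? g
        ... | no s≮g with m≤n⇒∃[o]m+o≡n (≮⇒≥ s≮g)
        ...   | u , refl = subst (_∈S S) (trans (+-assoc h u g) (cong (h +_) (+-comm u g)))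
                  (>qa⇒+g∈ (<-≤-trans qa<h (m≤m+n h u)))
        closure s 0<s s∈S | yes s<g with ∈⇒∣ s<g s∈S
        ... | divides zero refl = ⊥-elim (<-irrefl refl 0<s)
        ... | divides (suc k) refl =
          subst (_∈S S) (+-assoc h a (k * a)) (closed S (h + a) (k * a) h+a∈S (*a∈ k))

      qa+c∉ : ∀ {c} → 0 < c → c ≤ r → (q * a + c) ∉S S
      qa+c∉ {c} 0<c c≤r qa+c∈S with m≤n⇒m<n∨m≡n c≤r
      ... | inj₁ c<r = <⇒≱ (m<m+n (q * a) 0<c) (∈⇒≤qa (qa+c<g c<r) qa+c∈S)
      ... | inj₂ refl = g∉S (subst (_∈S S) (sym g≡qa+r) qa+c∈S)

      rem≤r⇒¬PF : ∀ m d {c} → 0 < c → c ≤ r → suc m + d ≡ q → ¬ IsPF S (c + m * a)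
      rem≤r⇒¬PF m d {c} 0<c c≤r m+d≡q (_ , closure) =
        qa+c∉ 0<c c≤r
          (subst (_∈S S) shift (closure (suc d * a) (<-≤-trans 0<a (m≤m+n a (d * a))) (*a∈ (suc d))))
        where
        rearrange : c + m * a + suc d * a ≡ (suc m + d) * a + c
        rearrange = solve (c ∷ m ∷ a ∷ d ∷ [])
        shift : c + m * a + suc d * a ≡ q * a + c
        shift = trans rearrange (cong (λ t → t * a + c) m+d≡q)

      rem>r⇒¬PF : ∀ m {c e} → r < c → 0 < e → c + e ≡ a → suc m ≤ q → ¬ IsPF S (c + m * a)
      rem>r⇒¬PF m {c} {e} r<c 0<e c+e≡a m<q (_ , closure) =
        ∈⇒+g∉ (≤-<-trans (*-monoˡ-≤ a m<q) qa<g) (*a∈ (suc m))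
          (subst (_∈S S) shift (closure (e + g) (<-≤-trans 0<e (m≤m+n e g)) (+g∈ λ _ → e∉S)))
        where
        e∉S : e ∉S S
        e∉S = 0<b<a⇒∉ 0<e (subst (e <_) c+e≡a (m<n+m e (≤-<-trans z≤n r<c)))
        rearrange : c + m * a + (e + g) ≡ c + e + m * a + g
        rearrange = solve (c ∷ m ∷ a ∷ e ∷ g ∷ [])
        shift : c + m * a + (e + g) ≡ suc m * a + g
        shift = trans rearrange (cong (λ t → t + m * a + g) c+e≡a)

      ≤qa⇒¬PF : ∀ m {c} → c < a → c + m * a ≤ q * a → ¬ IsPF S (c + m * a)
      ≤qa⇒¬PF m {zero} _ _ (hole , _) = hole (*a∈ m)
      ≤qa⇒¬PF m {suc c} c<a ≤qa with *-cancelʳ-< a m q (<-≤-trans (m<n+m (m * a) z<s) ≤qa)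
      ... | m<q with suc c ≤? r | m≤n⇒∃[o]m+o≡n m<q | m≤n⇒∃[o]m+o≡n (<⇒≤ c<a)
      ... | yes c≤r | d , m+d≡q | _ = rem≤r⇒¬PF m d z<s c≤r m+d≡q
      ... | no c≰r | _ | e , c+e≡a = rem>r⇒¬PF m (≰⇒> c≰r)
        (n≢0⇒n>0 λ { refl → <-irrefl (trans (sym (+-identityʳ (suc c))) c+e≡a) c<a }) c+e≡a m<q

      PF⇒>qa : ∀ {h} → IsPF S h → q * a < h
      PF⇒>qa {h} h-PF with q * a <? h
      ... | yes qa<h = qa<h
      ... | no qa≮h = ⊥-elim (≤qa⇒¬PF (h / a) (m%n<n h a)
        (subst (_≤ q * a) h≡ (≮⇒≥ qa≮h)) (subst (IsPF S) h≡ h-PF))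
        where
        h≡ : h ≡ h % a + h / a * a
        h≡ = m≡m%n+[m/n]*n h a

      PF≥g⇒top : ∀ {h} → IsPF S h → g ≤ h → h ≡ q * a + g
      PF≥g⇒top {h} (h∉S , closure) g≤h with h ∸ g | m∸n+n≡m g≤h
      ... | w | refl with w <? g
      ... | no w≮g = ⊥-elim (h∉S (≥2g⇒∈ (+-monoˡ-≤ g (≮⇒≥ w≮g))))
      ... | yes w<g with ∈⇒∣ w<g (+g∉⇒∈ w<g h∉S)
      ... | divides k refl with m≤n⇒m<n∨m≡n (*<*+⇒≤ k q r<a (subst (k * a <_) g≡qa+r w<g))
      ... | inj₂ refl = refl
      ... | inj₁ k<q = ⊥-elim (∈⇒+g∉ (≤-<-trans (*-monoˡ-≤ a k<q) qa<g) (*a∈ (suc k))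
        (subst (_∈S S) (trans (xy∙z≈xz∙y (k * a) g a) (cong (_+ g) (+-comm (k * a) a)))
          (closure a 0<a a∈S)))

      PF⇔ : ∀ h → IsPF S h ⇔ ((q * a < h × h < g) ⊎ h ≡ q * a + g)
      PF⇔ h = mk⇔ classify λ { (inj₁ (qa<h , h<g)) → interval-PF qa<h h<g ; (inj₂ refl) → top-PF }
        where
        classify : IsPF S h → (q * a < h × h < g) ⊎ h ≡ q * a + g
        classify h-PF with h <? g
        ... | yes h<g = inj₁ (PF⇒>qa h-PF , h<g)
        ... | no h≮g = inj₂ (PF≥g⇒top h-PF (≮⇒≥ h≮g))

      -- Index 0 carries the PF number q a + g, so that r indices enumerate all of PF(S).
      PF-enum : ℕ → ℕ
      PF-enum zero = q * a + g
      PF-enum (suc c) = q * a + suc c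

      type : IsType S r
      type =
        applyUpTo PF-enum r , applyUpTo⁺₁ PF-enum r distinct , enumerates , length-applyUpTo PF-enum r
        where
        distinct : ∀ {i j} → i < j → j < r → PF-enum i ≢ PF-enum j
        distinct {zero} {suc j} _ j<r eq =
          <-irrefl (sym (+-cancelˡ-≡ (q * a) g (suc j) eq))
            (<-≤-trans j<r (subst (r ≤_) (sym g≡qa+r) (m≤n+m r (q * a))))
        distinct {suc i} {suc j} i<j _ eq = <⇒≢ i<j (+-cancelˡ-≡ (q * a) _ _ eq)

        enumerates : ∀ h → h ∈ applyUpTo PF-enum r ⇔ IsPF S h
        enumerates h = mk⇔ to from
          where
          to : h ∈ applyUpTo PF-enum r → IsPF S h
          to h∈ with ∈-applyUpTo⁻ PF-enum h∈
          ... | zero , _ , refl = top-PF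
          ... | suc c , c<r , refl = interval-PF (m<m+n (q * a) z<s) (qa+c<g c<r)
          from : IsPF S h → h ∈ applyUpTo PF-enum r
          from h-PF with Equivalence.to (PF⇔ h) h-PF
          ... | inj₂ refl = ∈-applyUpTo⁺ PF-enum 0<r
          ... | inj₁ (qa<h , h<g) with m≤n⇒∃[o]m+o≡n qa<h
          ... | c , refl = subst (_∈ applyUpTo PF-enum r) (+-suc (q * a) c)
                  (∈-applyUpTo⁺ PF-enum
                    (+-cancelˡ-< (q * a) (suc c) r (subst₂ _<_ (sym (+-suc (q * a) c)) g≡qa+r h<g)))

      2g∸r≡qa+g : 2 * g ∸ r ≡ q * a + g
      2g∸r≡qa+g = begin
        2 * g ∸ r               ≡⟨ cong (λ t → g + t ∸ r) (+-identityʳ g) ⟩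
        g + g ∸ r               ≡⟨ cong (λ t → t + g ∸ r) g≡qa+r ⟩
        q * a + r + g ∸ r       ≡⟨ cong (_∸ r) (xy∙z≈xz∙y (q * a) r g) ⟩
        q * a + g + r ∸ r       ≡⟨ m+n∸n≡m (q * a + g) r ⟩
        q * a + g               ∎
        where open ≡-Reasoning

      stated-form⇔ : ∀ h → ((g + 1 ≤ h + r × h + 1 ≤ g) ⊎ h ≡ 2 * g ∸ r)
                         ⇔ ((q * a < h × h < g) ⊎ h ≡ q * a + g)
      stated-form⇔ h =
        (lower ×-⇔ upper) ⊎-⇔ mk⇔ (λ e → trans e 2g∸r≡qa+g) (λ e → trans e (sym 2g∸r≡qa+g))
        where
        g+1≡ : g + 1 ≡ suc (q * a) + r
        g+1≡ = trans (cong (_+ 1) g≡qa+r) (solve (q ∷ a ∷ r ∷ []))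
        lower : g + 1 ≤ h + r ⇔ q * a < h
        lower = mk⇔ (λ le → +-cancelʳ-≤ r (suc (q * a)) h (subst (_≤ h + r) g+1≡ le))
                    (λ lt → subst (_≤ h + r) (sym g+1≡) (+-monoˡ-≤ r lt))
        upper : h + 1 ≤ g ⇔ h < g
        upper = mk⇔ (subst (_≤ g) (+-comm h 1)) (subst (_≤ g) (+-comm 1 h))

proposition4p6 : (S : NumericalSemigroup) (g a q r : ℕ) →
    IsReflective S → IsGenus S g → 1 ≤ g → IsMultiplicity S a →
    g ≡ q * a + r → r < a →
    ((∀ h → IsPF S h ⇔ ((g + 1 ≤ h + r × h + 1 ≤ g) ⊎ h ≡ (2 * g) ∸ r))
      × IsType S r)
proposition4p6 S g a q r (g′ , genus′ , _ , reflect) genus 0<g multiplicity g≡qa+r r<a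
  with HasCard-unique genus′ genus
... | refl = (λ h → PF⇔ h ⇔-then ⇔-sym (stated-form⇔ h)) , type
  where
  open Reflective S 0<g reflect genus
  open Multiplicity multiplicity
  open Division q r g≡qa+r r<a
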